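{- Let $\mathcal{I}$ be a Routley IF and $p$ an atomic formula. If both $p\vdash\neg\neg p$ and $\neg\neg p\vdash p$ are valid in $\mathcal{I}$, then $\mathcal{I}$ is linearly ordered by $\le$.
   Context: Let $L$ be the set of formulas built from a set $At$ of atomic formulas with $\wedge,\vee,\neg$. A Routley IF is a structure $\langle S,\circ,*,i,e\rangle$ where $S$ is a nonempty set, $\circ$ is an associative, commutative, idempotent binary operation on $S$, $*:S\to S$, and $i\neq e$ are elements of $S$ such that: $s\circ i=s$ and $s\circ e=e$ for all $s$; if $e=t\circ u$ then $e=t$ or $e=u$; and, writing $s\le t$ iff $s\circ t=s$: $i^*=e$ and $e^*=i$; $t\le u$ implies $u^*\le t^*$; for all $t,u$, $(t\circ u)^*\le t^*$ or $(t\circ u)^*\le u^*$. A proper filter is $F\subseteq S$ with $i\in F$, $e\notin F$, and $t\circ u\in F$ iff $t\in F$ and $u\in F$. A Routley IM is a Routley IF with a valuation $V$ assigning a proper filter to each atom. Support: $s\Vdash p$ iff $s\in V(p)$; $s\Vdash\alpha\wedge\beta$ iff $s\Vdash\alpha$ and $s\Vdash\beta$; $s\Vdash\alpha\vee\beta$ iff there are $t,u$ with $t\Vdash\alpha$, $u\Vdash\beta$, $t\circ u\le s$; $s\Vdash\neg\alpha$ iff $s^*\nVdash\alpha$. A pair $\alpha\vdash\beta$ is valid in a Routley IF if in every Routley IM based on it every state supporting $\alpha$ supports $\beta$. -}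

module Defs where

open import Data.Product using (Σ; ∃; ∃-syntax; _×_; _,_)
open import Data.Sum using (_⊎_)
open import Relation.Binary.PropositionalEquality using (_≡_; _≢_)
open import Relation.Nullary using (¬_)

record RoutleyIF : Set₁ where
  infixl 7 _∘_
  infix 9 _*
  field
    S     : Set
    _∘_   : S → S → S
    _*    : S → S
    i     : S
    e     : S
    i≢e   : i ≢ e
    assoc : ∀ s t u → (s ∘ t) ∘ u ≡ s ∘ (t ∘ u)
    comm  : ∀ s t → s ∘ t ≡ t ∘ s
    idem  : ∀ s → s ∘ s ≡ s
    unitʳ : ∀ s → s ∘ i ≡ s
    zeroʳ : ∀ s → s ∘ e ≡ e
    e-prime : ∀ t u → e ≡ t ∘ u → (e ≡ t) ⊎ (e ≡ u)
    i*≡e  : i * ≡ e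
    e*≡i  : e * ≡ i
    -- t ≤ u implies u* ≤ t*   (x ≤ y  means  x ∘ y ≡ x)
    *-antitone : ∀ t u → t ∘ u ≡ t → u * ∘ t * ≡ u *
    *-split : ∀ t u → ((t ∘ u) * ∘ t * ≡ (t ∘ u) *) ⊎ ((t ∘ u) * ∘ u * ≡ (t ∘ u) *)

  infix 4 _≤_
  _≤_ : S → S → Set
  s ≤ t = s ∘ t ≡ s

module _ (I : RoutleyIF) where
  open RoutleyIF I

  record ProperFilter : Set₁ where
    field
      mem     : S → Set
      i∈      : mem i
      e∉      : ¬ mem e
      ∘-intro : ∀ t u → mem t → mem u → mem (t ∘ u)
      ∘-elim  : ∀ t u → mem (t ∘ u) → mem t × mem u

data Formula (At : Set) : Set where
  atom : At → Formula At
  _∧'_ : Formula At → Formula At → Formula At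
  _∨'_ : Formula At → Formula At → Formula At
  ¬'_  : Formula At → Formula At

Valuation : RoutleyIF → Set → Set₁
Valuation I At = At → ProperFilter I

module _ (I : RoutleyIF) {At : Set} (V : Valuation I At) where
  open RoutleyIF I

  infix 3 _⊩_
  _⊩_ : S → Formula At → Set
  s ⊩ atom p  = ProperFilter.mem (V p) s
  s ⊩ (α ∧' β) = (s ⊩ α) × (s ⊩ β)
  s ⊩ (α ∨' β) = ∃[ t ] ∃[ u ] ((t ⊩ α) × (u ⊩ β) × (t ∘ u ≤ s))
  s ⊩ (¬' α)  = ¬ ((s *) ⊩ α)

Valid : (I : RoutleyIF) (At : Set) → Formula At → Formula At → Set₁
Valid I At α β = (V : Valuation I At) (s : RoutleyIF.S I) → _⊩_ I V s α → _⊩_ I V s β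

LinearlyOrdered : RoutleyIF → Set
LinearlyOrdered I = ∀ s t → (s ≤ t) ⊎ (t ≤ s)
  where open RoutleyIF I

-- Valuing every atom by a principal filter ↑a (proper as long as a ≠ e), validity of
-- p ⊢ ¬¬p yields a ≤ a** and validity of ¬¬p ⊢ p yields a** ≤ a, so * is an involution.
-- For an involutive *, the split axiom (t∘u)* ≤ t* or (t∘u)* ≤ u* together with
-- antitonicity gives (t∘u)* = t* or (t∘u)* = u*, hence t∘u = t or t∘u = u.
module Submission where

open import Defs
open import Level using (0ℓ)
open import Axiom.ExcludedMiddle using (ExcludedMiddle)
open import Axiom.DoubleNegationElimination using (DoubleNegationElimination; em⇒dne)
open import Data.Product using (_,_)
open import Data.Sum using (inj₁; inj₂)
open import Relation.Nullary using (yes; no)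
open import Relation.Binary.PropositionalEquality

module _ (I : RoutleyIF) where
  open RoutleyIF I
  open ≡-Reasoning

  ≤-trans : ∀ {s t u} → s ≤ t → t ≤ u → s ≤ u
  ≤-trans {s} {t} {u} s≤t t≤u = begin
    s ∘ u        ≡⟨ cong (_∘ u) (sym s≤t) ⟩
    s ∘ t ∘ u    ≡⟨ assoc s t u ⟩
    s ∘ (t ∘ u)  ≡⟨ cong (s ∘_) t≤u ⟩
    s ∘ t        ≡⟨ s≤t ⟩
    s            ∎

  ≤-antisym : ∀ {s t} → s ≤ t → t ≤ s → s ≡ t
  ≤-antisym {s} {t} s≤t t≤s = trans (sym s≤t) (trans (comm s t) t≤s)

  x∘y≤x : ∀ x y → x ∘ y ≤ x
  x∘y≤x x y = begin
    x ∘ y ∘ x    ≡⟨ comm (x ∘ y) x ⟩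
    x ∘ (x ∘ y)  ≡⟨ sym (assoc x x y) ⟩
    x ∘ x ∘ y    ≡⟨ cong (_∘ y) (idem x) ⟩
    x ∘ y        ∎

  x∘y≤y : ∀ x y → x ∘ y ≤ y
  x∘y≤y x y = trans (assoc x y y) (cong (x ∘_) (idem y))

  ∘-greatest : ∀ {s t u} → s ≤ t → s ≤ u → s ≤ t ∘ u
  ∘-greatest {s} {t} {u} s≤t s≤u =
    trans (sym (assoc s t u)) (trans (cong (_∘ u) s≤t) s≤u)

  ≤e⇒≡e : ∀ {s} → s ≤ e → s ≡ e
  ≤e⇒≡e {s} s≤e = trans (sym s≤e) (zeroʳ s)

  principalFilter : (a : S) → a ≢ e → ProperFilter I
  principalFilter a a≢e = record
    { mem     = a ≤_
    ; i∈      = unitʳ a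
    ; e∉      = λ a≤e → a≢e (≤e⇒≡e a≤e)
    ; ∘-intro = λ _ _ → ∘-greatest
    ; ∘-elim  = λ t u a≤t∘u → ≤-trans a≤t∘u (x∘y≤x t u) , ≤-trans a≤t∘u (x∘y≤y t u)
    }

  *-injective : (∀ x → (x *) * ≡ x) → ∀ {t u} → t * ≡ u * → t ≡ u
  *-injective involutive {t} {u} t*≡u* = begin
    t          ≡⟨ sym (involutive t) ⟩
    (t *) *    ≡⟨ cong _* t*≡u* ⟩
    (u *) *    ≡⟨ involutive u ⟩
    u          ∎

  involutive⇒linearlyOrdered : (∀ x → (x *) * ≡ x) → LinearlyOrdered I
  involutive⇒linearlyOrdered involutive t u with *-split t u
  ... | inj₁ [t∘u]*≤t* = inj₁ (*-injective involutive
          (≤-antisym [t∘u]*≤t* (*-antitone (t ∘ u) t (x∘y≤x t u))))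
  ... | inj₂ [t∘u]*≤u* = inj₂ (trans (comm u t) (*-injective involutive
          (≤-antisym [t∘u]*≤u* (*-antitone (t ∘ u) u (x∘y≤y t u)))))

module _ (I : RoutleyIF) {At : Set} (p : At) where
  open RoutleyIF I

  x≤x** : DoubleNegationElimination 0ℓ → Valid I At (atom p) (¬' (¬' (atom p))) →
          ∀ {x} → x ≢ e → x ≤ (x *) *
  x≤x** dne valid {x} x≢e = dne (valid (λ _ → principalFilter I x x≢e) x (idem x))

  x**≤x : Valid I At (¬' (¬' (atom p))) (atom p) →
          ∀ {x} → (x *) * ≢ e → (x *) * ≤ x
  x**≤x valid {x} x**≢e =
    valid (λ _ → principalFilter I ((x *) *) x**≢e) x (λ x**∉↑x** → x**∉↑x** (idem ((x *) *)))

  **-involutive : ExcludedMiddle 0ℓ →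
                  Valid I At (atom p) (¬' (¬' (atom p))) →
                  Valid I At (¬' (¬' (atom p))) (atom p) →
                  ∀ x → (x *) * ≡ x
  **-involutive em valid→ valid← x with em {x ≡ e}
  ... | yes refl = trans (cong _* e*≡i) i*≡e
  ... | no x≢e   = sym (≤-antisym I x≤x**′ (x**≤x valid← x**≢e))
    where
    x≤x**′ : x ≤ (x *) *
    x≤x**′ = x≤x** (em⇒dne em) valid→ x≢e

    x**≢e : (x *) * ≢ e
    x**≢e x**≡e = x≢e (≤e⇒≡e I (subst (x ≤_) x**≡e x≤x**′))

proposition6 : ExcludedMiddle 0ℓ → (I : RoutleyIF) (At : Set) (p : At) →
                 Valid I At (atom p) (¬' (¬' (atom p))) →
                 Valid I At (¬' (¬' (atom p))) (atom p) →
                 LinearlyOrdered I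
proposition6 em I At p valid→ valid← =
  involutive⇒linearlyOrdered I (**-involutive I p em valid→ valid←)
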